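{- Every ample positive integer $n$ is either abundant (i.e. $\sigma(n) - n > n$) or an odd perfect number (i.e. $n$ is odd and $\sigma(n) - n = n$).
   Context: $\sigma(n)$ denotes the sum of all positive divisors of $n$. For positive integers, write $m \lfloor n$ to mean that $m$ is a proper divisor of $n$. The number of recursive divisors is defined by $a(1)=1$ and $a(n) = 1 + \sum_{m \lfloor n} a(m)$ for $n>1$. A positive integer $n$ is ample if $a(n) > n$. -}

module Defs where

open import Data.Nat using (ℕ; zero; suc; _+_; _<_; _≤_)
open import Data.Nat.Divisibility using (_∣_; _∣?_)
open import Data.Product using (_×_)
open import Relation.Nullary using (¬_)
open import Relation.Binary.PropositionalEquality using (_≡_)
open import Data.List using (List; filter; map; upTo; drop)
open import Data.Nat.ListAction using (sum)

below : ℕ → List ℕ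
below n = drop 1 (upTo n)

properDivisors : ℕ → List ℕ
properDivisors n = filter (λ m → m ∣? n) (below n)

σ : ℕ → ℕ
σ n = n + sum (properDivisors n)

-- Number of recursive divisors: a(1) = 1, a(n) = 1 + Σ_{m proper divisor of n} a(m).
-- Implemented with a fuel argument; every proper divisor m of n satisfies m < n,
-- so fuel n is always sufficient (aux k m for k ≥ m computes a(m)).
aux : ℕ → ℕ → ℕ
aux zero    n = 1
aux (suc k) n = 1 + sum (map (aux k) (properDivisors n))

a : ℕ → ℕ
a n = aux n n

Ample : ℕ → Set
Ample n = n < a n

Abundant : ℕ → Set
Abundant n = n + n < σ n

OddPerfect : ℕ → Set
OddPerfect n = ¬ (2 ∣ n) × σ n ≡ n + n

{-# OPTIONS --safe #-}
module Submission where

-- Write s(n) for the sum of the proper divisors.  If s(n) ≤ n then every proper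
-- divisor d is deficient, s(d) < d: with n = q d, q ≥ 2, the divisors of n include
-- 1 and the q e for e ∣ d, so 1 + q σ(d) ≤ σ(n) ≤ 2n.  Strong induction then gives
-- a(n) = 1 + Σ a(e) ≤ 1 + s(n) ≤ n for deficient n.  For an even perfect n = 2m
-- this yields a(e) ≤ e on all proper divisors, and strictly a(m) < m: an even
-- perfect number has an odd divisor o ≥ 3 (otherwise its divisors are 1 and twice
-- those of m, and 4m ≤ 1 + 2σ(m) contradicts s(m) < m), and 1 + o + 2σ(m) ≤ 4m
-- forces s(m) ≤ m − 2.  Hence a(n) ≤ s(n) = n.

open import Defs
open import Data.Nat
  using (ℕ; zero; suc; _+_; _*_; _≤_; _<_; _>_; z≤n; s≤s; z<s; s<s; NonZero; >-nonZero; >-nonZero⁻¹; _≟_; _<?_)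
open import Data.Nat.Properties
open import Algebra.Properties.CommutativeSemigroup +-commutativeSemigroup using (x∙yz≈y∙xz)
open import Data.Nat.Divisibility
  using (_∣_; _∤_; _∣?_; divides; 1∣_; ∣-refl; ∣⇒≤; >⇒∤; m∣m*n; n∣m*n; *-monoʳ-∣; *-cancelˡ-∣)
open import Data.Nat.Induction using (<-wellFounded)
open import Data.Nat.ListAction using (sum)
open import Data.Nat.ListAction.Properties using (sum-++)
open import Data.Nat.Tactic.RingSolver using (solve-∀)
open import Data.List using (List; []; _∷_; _++_; map; applyUpTo)
open import Data.List.Properties using (map-id; map-cong-local)
open import Data.List.Membership.Propositional using (_∈_; find; lose)
open import Data.List.Membership.Propositional.Properties
  using (∈-∃++; ∈-++⁻; ∈-++⁺ˡ; ∈-++⁺ʳ; ∈-map⁺; ∈-map⁻; ∈-filter⁺; ∈-filter⁻;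
         ∈-applyUpTo⁺; ∈-applyUpTo⁻)
open import Data.List.Relation.Binary.Subset.Propositional using (_⊆_)
open import Data.List.Relation.Unary.Any using (Any; here; there; any?)
open import Data.List.Relation.Unary.All using ([]; _∷_)
import Data.List.Relation.Unary.All as All
open import Data.List.Relation.Unary.AllPairs using ([]; _∷_)
open import Data.List.Relation.Unary.Unique.Propositional using (Unique)
import Data.List.Relation.Unary.Unique.Propositional.Properties as Unique
open import Data.Product using (_×_; _,_; proj₁; proj₂)
open import Data.Sum using (_⊎_; inj₁; inj₂)
open import Data.Empty using (⊥-elim)
open import Function using (_∘_; id)
open import Induction.WellFounded using (Acc; acc)
open import Relation.Binary.Definitions using (tri<; tri≈; tri>)
open import Relation.Binary.PropositionalEquality using (_≡_; refl; sym; trans; cong; subst)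
open import Relation.Nullary using (¬_; yes; no)
open import Relation.Nullary.Decidable using (_×-dec_; ¬?)

sum-mono-⊆ : ∀ {xs ys : List ℕ} → Unique xs → xs ⊆ ys → sum xs ≤ sum ys
sum-mono-⊆ {[]} _ _ = z≤n
sum-mono-⊆ {x ∷ xs} (x∉xs ∷ uniq) xs⊆ys
  with ys₁ , ys₂ , refl ← ∈-∃++ (xs⊆ys (here refl)) = begin
    x + sum xs                 ≤⟨ +-monoʳ-≤ x (sum-mono-⊆ uniq xs⊆ys₁++ys₂) ⟩
    x + sum (ys₁ ++ ys₂)       ≡⟨ cong (x +_) (sum-++ ys₁ ys₂) ⟩
    x + (sum ys₁ + sum ys₂)    ≡⟨ x∙yz≈y∙xz x (sum ys₁) (sum ys₂) ⟩
    sum ys₁ + (x + sum ys₂)    ≡⟨ sym (sum-++ ys₁ (x ∷ ys₂)) ⟩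
    sum (ys₁ ++ x ∷ ys₂)       ∎
  where
  open ≤-Reasoning
  xs⊆ys₁++ys₂ : xs ⊆ ys₁ ++ ys₂
  xs⊆ys₁++ys₂ z∈xs with ∈-++⁻ ys₁ (xs⊆ys (there z∈xs))
  ... | inj₁ z∈ys₁         = ∈-++⁺ˡ z∈ys₁
  ... | inj₂ (here refl)   = ⊥-elim (All.lookup x∉xs z∈xs refl)
  ... | inj₂ (there z∈ys₂) = ∈-++⁺ʳ ys₁ z∈ys₂

sum-map-mono-≤ : ∀ (f g : ℕ → ℕ) xs → (∀ {x} → x ∈ xs → f x ≤ g x) →
                 sum (map f xs) ≤ sum (map g xs)
sum-map-mono-≤ f g []       _   = z≤n
sum-map-mono-≤ f g (x ∷ xs) f≤g =
  +-mono-≤ (f≤g (here refl)) (sum-map-mono-≤ f g xs (f≤g ∘ there))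

sum-map-mono-< : ∀ (f g : ℕ → ℕ) xs {y} → y ∈ xs → f y < g y →
                 (∀ {x} → x ∈ xs → f x ≤ g x) → sum (map f xs) < sum (map g xs)
sum-map-mono-< f g (x ∷ xs) (here refl) fy<gy f≤g =
  +-mono-<-≤ fy<gy (sum-map-mono-≤ f g xs (f≤g ∘ there))
sum-map-mono-< f g (x ∷ xs) (there y∈xs) fy<gy f≤g =
  +-mono-≤-< (f≤g (here refl)) (sum-map-mono-< f g xs y∈xs fy<gy (f≤g ∘ there))

sum-map-*ˡ : ∀ k xs → sum (map (k *_) xs) ≡ k * sum xs
sum-map-*ˡ k []       = sym (*-zeroʳ k)
sum-map-*ˡ k (x ∷ xs) =
  trans (cong (k * x +_) (sum-map-*ˡ k xs)) (sym (*-distribˡ-+ k x (sum xs)))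

m*n>0 : ∀ m {n} .{{_ : NonZero m}} → n > 0 → m * n > 0
m*n>0 m {n} 0<n = ≤-trans 0<n (m≤n*m n m)

divisors : ℕ → List ℕ
divisors n = n ∷ properDivisors n

aliquot : ℕ → ℕ
aliquot n = sum (properDivisors n)

Deficient : ℕ → Set
Deficient n = aliquot n < n

∈-properDivisors⁻ : ∀ {n m} → m ∈ properDivisors n → 0 < m × m < n × m ∣ n
∈-properDivisors⁻ {suc n} m∈
  with m∈range , m∣n ← ∈-filter⁻ (_∣? suc n) {xs = applyUpTo suc n} m∈
  with i , i<n , refl ← ∈-applyUpTo⁻ suc m∈range = z<s , s<s i<n , m∣n

∈-properDivisors⁺ : ∀ {n m} → 0 < m → m < n → m ∣ n → m ∈ properDivisors n
∈-properDivisors⁺ {suc n} {suc m} _ (s≤s m<n) m∣n =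
  ∈-filter⁺ (_∣? suc n) {xs = applyUpTo suc n} (∈-applyUpTo⁺ suc m<n) m∣n

∈-divisors⁻ : ∀ {n m} → 0 < n → m ∈ divisors n → 0 < m × m ∣ n
∈-divisors⁻ 0<n (here refl) = 0<n , ∣-refl
∈-divisors⁻ _   (there m∈)  with 0<m , _ , m∣n ← ∈-properDivisors⁻ m∈ = 0<m , m∣n

∈-divisors⁺ : ∀ {n m} → 0 < n → 0 < m → m ∣ n → m ∈ divisors n
∈-divisors⁺ {n} {m} 0<n 0<m m∣n with m ≟ n
... | yes refl = here refl
... | no  m≢n  = there (∈-properDivisors⁺ 0<m (≤∧≢⇒< (∣⇒≤ {{>-nonZero 0<n}} m∣n) m≢n) m∣n)

properDivisors-unique : ∀ n → Unique (properDivisors n)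
properDivisors-unique n = Unique.filter⁺ (_∣? n) (Unique.drop⁺ 1 (Unique.upTo⁺ n))

divisors-unique : ∀ n → Unique (divisors n)
divisors-unique n =
  All.tabulate (λ m∈ n≡m → <-irrefl (sym n≡m) (proj₁ (proj₂ (∈-properDivisors⁻ m∈))))
  ∷ properDivisors-unique n

aux-fuel-irrelevant : ∀ {k j} m → m ≤ k → m ≤ j → aux k m ≡ aux j m
aux-fuel-irrelevant {zero}  {zero}  m       _   _   = refl
aux-fuel-irrelevant {zero}  {suc j} zero    _   _   = refl
aux-fuel-irrelevant {suc k} {zero}  zero    _   _   = refl
aux-fuel-irrelevant {suc k} {suc j} m       m≤k m≤j =
  cong (λ xs → 1 + sum xs) (map-cong-local {xs = properDivisors m} (All.tabulate λ e∈ →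
    let e<m = proj₁ (proj₂ (∈-properDivisors⁻ e∈))
    in aux-fuel-irrelevant _ (≤-pred (≤-trans e<m m≤k)) (≤-pred (≤-trans e<m m≤j))))

a-suc : ∀ m → a (suc m) ≡ 1 + sum (map a (properDivisors (suc m)))
a-suc m =
  cong (λ xs → 1 + sum xs) (map-cong-local {f = aux m} {g = a} {xs = properDivisors (suc m)}
    (All.tabulate λ {e} e∈ →
      aux-fuel-irrelevant {m} e (≤-pred (proj₁ (proj₂ (∈-properDivisors⁻ e∈)))) ≤-refl))

σ-multiple : ∀ k {d ws} .{{_ : NonZero k}} → 0 < d → Unique ws →
             (∀ {w} → w ∈ ws → w ∈ divisors (k * d) × k ∤ w) →
             sum ws + k * σ d ≤ σ (k * d)
σ-multiple k {d} {ws} 0<d ws-unique ws-divisors =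
  subst (_≤ σ (k * d)) sum-xs
    (sum-mono-⊆ (Unique.++⁺ ws-unique multiples-unique disjoint) xs⊆divisors)
  where
  multiples = map (k *_) (divisors d)
  sum-xs : sum (ws ++ multiples) ≡ sum ws + k * σ d
  sum-xs = trans (sum-++ ws multiples) (cong (sum ws +_) (sum-map-*ˡ k (divisors d)))
  multiples-unique : Unique multiples
  multiples-unique = Unique.map⁺ (*-cancelˡ-≡ _ _ k) (divisors-unique d)
  disjoint : ∀ {v} → ¬ (v ∈ ws × v ∈ multiples)
  disjoint (v∈ws , v∈multiples) with e , _ , refl ← ∈-map⁻ (k *_) v∈multiples =
    proj₂ (ws-divisors v∈ws) (m∣m*n e)
  xs⊆divisors : ws ++ multiples ⊆ divisors (k * d)
  xs⊆divisors v∈ with ∈-++⁻ ws v∈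
  ... | inj₁ v∈ws = proj₁ (ws-divisors v∈ws)
  ... | inj₂ v∈multiples with e , e∈ , refl ← ∈-map⁻ (k *_) v∈multiples
    with 0<e , e∣d ← ∈-divisors⁻ 0<d e∈ =
      ∈-divisors⁺ (m*n>0 k 0<d) (m*n>0 k 0<e) (*-monoʳ-∣ k e∣d)

σ-all-multiples : ∀ k {m} .{{_ : NonZero k}} → 0 < m →
                  (∀ {x} → x ∈ divisors (k * m) → x ≡ 1 ⊎ k ∣ x) →
                  σ (k * m) ≤ 1 + k * σ m
σ-all-multiples k {m} 0<m one-or-multiple =
  subst (σ (k * m) ≤_) (cong suc (sum-map-*ˡ k (divisors m)))
    (sum-mono-⊆ (divisors-unique (k * m)) divisors⊆)
  where
  divisors⊆ : divisors (k * m) ⊆ 1 ∷ map (k *_) (divisors m)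
  divisors⊆ {x} x∈ with one-or-multiple x∈
  ... | inj₁ refl = here refl
  ... | inj₂ (divides f refl)
    with 0<x , x∣km ← ∈-divisors⁻ (m*n>0 k 0<m) x∈ rewrite *-comm f k =
    there (∈-map⁺ (k *_) (∈-divisors⁺ 0<m 0<f (*-cancelˡ-∣ k x∣km)))
    where
    0<f : 0 < f
    0<f = >-nonZero⁻¹ f {{m*n≢0⇒n≢0 k {{>-nonZero 0<x}}}}

deficient⇒0< : ∀ {n} → Deficient n → 0 < n
deficient⇒0< {suc n} _ = z<s

properDivisor-deficient : ∀ {n d} → aliquot n ≤ n → d ∈ properDivisors n → Deficient d
properDivisor-deficient {n} {d} not-abundant d∈
  with 0<d , d<n , divides q refl ← ∈-properDivisors⁻ {n} d∈ =
  +-cancelˡ-< d (aliquot d) d (*-cancelˡ-< q (σ d) (d + d) (begin-strict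
    q * σ d               <⟨ n<1+n _ ⟩
    1 + q * σ d           ≤⟨ σ-multiple q 0<d ([] ∷ []) (λ { (here refl) → 1∈divisors , >⇒∤ 1<q }) ⟩
    σ (q * d)             ≤⟨ +-monoʳ-≤ (q * d) not-abundant ⟩
    q * d + q * d         ≡⟨ *-distribˡ-+ q d d ⟨
    q * (d + d)           ∎))
  where
  open ≤-Reasoning
  1<q : 1 < q
  1<q = *-cancelʳ-< d 1 q (subst (_< q * d) (sym (*-identityˡ d)) d<n)
  instance
    q≢0 : NonZero q
    q≢0 = >-nonZero (<-trans z<s 1<q)
  1∈divisors : 1 ∈ divisors (q * d)
  1∈divisors = ∈-divisors⁺ (m*n>0 q 0<d) z<s (1∣ _)

a≤suc-aliquot : ∀ {n} → 0 < n → (∀ {e} → e ∈ properDivisors n → a e ≤ e) → a n ≤ suc (aliquot n)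
a≤suc-aliquot {suc n} _ a≤id rewrite a-suc n =
  s≤s (subst (sum (map a (properDivisors (suc n))) ≤_) (cong sum (map-id (properDivisors (suc n))))
    (sum-map-mono-≤ a id (properDivisors (suc n)) a≤id))

a≤aliquot : ∀ {n e} → e ∈ properDivisors n → a e < e →
            (∀ {e} → e ∈ properDivisors n → a e ≤ e) → a n ≤ aliquot n
a≤aliquot {suc n} e∈ ae<e a≤id rewrite a-suc n =
  subst (sum (map a (properDivisors (suc n))) <_) (cong sum (map-id (properDivisors (suc n))))
    (sum-map-mono-< a id (properDivisors (suc n)) e∈ ae<e a≤id)

a≤suc-aliquot-deficient : ∀ {n} → Deficient n → a n ≤ suc (aliquot n)
a≤suc-aliquot-deficient {n} = go (<-wellFounded n)
  where
  go : ∀ {m} → Acc _<_ m → Deficient m → a m ≤ suc (aliquot m)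
  go (acc rec) m-deficient = a≤suc-aliquot (deficient⇒0< m-deficient) λ e∈ →
    let e-deficient = properDivisor-deficient (<⇒≤ m-deficient) e∈
    in ≤-trans (go (rec (proj₁ (proj₂ (∈-properDivisors⁻ e∈)))) e-deficient) e-deficient

a≤-deficient : ∀ {n} → Deficient n → a n ≤ n
a≤-deficient n-deficient = ≤-trans (a≤suc-aliquot-deficient n-deficient) n-deficient

half∈properDivisors : ∀ {m} → 0 < m → m ∈ properDivisors (2 * m)
half∈properDivisors {m} 0<m = ∈-properDivisors⁺ 0<m (m<m+n m (≤-trans 0<m (m≤m+n m 0))) (n∣m*n 2)

evenPerfect-oddDivisor : ∀ {m} → 0 < m → aliquot (2 * m) ≡ 2 * m →
                         Any (λ o → 1 < o × 2 ∤ o) (divisors (2 * m))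
evenPerfect-oddDivisor {m} 0<m perfect
  with any? (λ o → (1 <? o) ×-dec ¬? (2 ∣? o)) (divisors (2 * m))
... | yes has-odd = has-odd
... | no no-odd = ⊥-elim (1+n≰n (begin
    2 + 2 * σ m                  ≡⟨ regroup m (aliquot m) ⟩
    2 * suc (aliquot m) + 2 * m  ≤⟨ +-monoˡ-≤ (2 * m) (*-monoʳ-≤ 2 m-deficient) ⟩
    2 * m + 2 * m                ≡⟨ cong (2 * m +_) perfect ⟨
    σ (2 * m)                    ≤⟨ σ-all-multiples 2 0<m one-or-even ⟩
    1 + 2 * σ m                  ∎))
  where
  open ≤-Reasoning
  regroup : ∀ m s → 2 + 2 * (m + s) ≡ 2 * suc s + 2 * m
  regroup = solve-∀
  m-deficient : Deficient m
  m-deficient = properDivisor-deficient (≤-reflexive perfect) (half∈properDivisors 0<m)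
  one-or-even : ∀ {x} → x ∈ divisors (2 * m) → x ≡ 1 ⊎ 2 ∣ x
  one-or-even {x} x∈ with x ≟ 1 | 2 ∣? x
  ... | yes x≡1 | _       = inj₁ x≡1
  ... | no _    | yes 2∣x = inj₂ 2∣x
  ... | no x≢1  | no x-odd =
    ⊥-elim (no-odd (lose x∈ (≤∧≢⇒< (proj₁ (∈-divisors⁻ (m*n>0 2 0<m) x∈)) (x≢1 ∘ sym) , x-odd)))

half-aliquot-bound : ∀ {m o} → 0 < m → aliquot (2 * m) ≤ 2 * m →
                     o ∈ divisors (2 * m) → 1 < o → 2 ∤ o → 2 + aliquot m ≤ m
half-aliquot-bound {m} {o} 0<m not-abundant o∈ 1<o o-odd =
  *-cancelˡ-≤ 2 (+-cancelʳ-≤ (2 * m) (2 * (2 + aliquot m)) (2 * m) (begin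
    2 * (2 + aliquot m) + 2 * m  ≡⟨ regroup m (aliquot m) ⟩
    1 + (3 + 0) + 2 * σ m        ≤⟨ +-monoˡ-≤ (2 * σ m) (s≤s (+-monoˡ-≤ 0 (3≤odd o 1<o o-odd))) ⟩
    1 + (o + 0) + 2 * σ m        ≤⟨ σ-multiple 2 0<m 1,o-unique 1,o-divisors ⟩
    σ (2 * m)                    ≤⟨ +-monoʳ-≤ (2 * m) not-abundant ⟩
    2 * m + 2 * m                ∎))
  where
  open ≤-Reasoning
  regroup : ∀ m s → 2 * (2 + s) + 2 * m ≡ 1 + (3 + 0) + 2 * (m + s)
  regroup = solve-∀
  3≤odd : ∀ x → 1 < x → 2 ∤ x → 3 ≤ x
  3≤odd (suc zero)          (s<s ()) _
  3≤odd (suc (suc zero))    _ x-odd = ⊥-elim (x-odd ∣-refl)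
  3≤odd (suc (suc (suc _))) _ _     = s≤s (s≤s (s≤s z≤n))
  1,o-unique : Unique (1 ∷ o ∷ [])
  1,o-unique = ((λ 1≡o → <-irrefl 1≡o 1<o) ∷ []) ∷ [] ∷ []
  1,o-divisors : ∀ {w} → w ∈ 1 ∷ o ∷ [] → w ∈ divisors (2 * m) × 2 ∤ w
  1,o-divisors (here refl)         = ∈-divisors⁺ (m*n>0 2 0<m) z<s (1∣ _) , >⇒∤ (s<s z<s)
  1,o-divisors (there (here refl)) = o∈ , o-odd

a≤-evenPerfect : ∀ {n} → 0 < n → 2 ∣ n → aliquot n ≡ n → a n ≤ n
a≤-evenPerfect {n} 0<n (divides m n≡m*2) perfect with refl ← trans n≡m*2 (*-comm m 2) =
  ≤-trans (a≤aliquot {2 * m} m∈ am<m (a≤-deficient ∘ properDivisor-deficient not-abundant)) not-abundant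
  where
  0<m : 0 < m
  0<m = *-cancelˡ-< 2 0 m 0<n
  m∈ : m ∈ properDivisors (2 * m)
  m∈ = half∈properDivisors 0<m
  not-abundant : aliquot (2 * m) ≤ 2 * m
  not-abundant = ≤-reflexive perfect
  am<m : a m < m
  am<m with o , o∈ , 1<o , o-odd ← find (evenPerfect-oddDivisor 0<m perfect) =
    ≤-<-trans (a≤suc-aliquot-deficient (properDivisor-deficient not-abundant m∈))
              (half-aliquot-bound 0<m not-abundant o∈ 1<o o-odd)

theorem2 : (n : ℕ) → 0 < n → Ample n → Abundant n ⊎ OddPerfect n
theorem2 n 0<n ample with <-cmp (aliquot n) n
... | tri< deficient _ _ = ⊥-elim (<⇒≱ ample (a≤-deficient deficient))
... | tri> _ _ abundant  = inj₁ (+-monoʳ-< n abundant)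
... | tri≈ _ perfect _ with 2 ∣? n
...   | no odd   = inj₂ (odd , cong (n +_) perfect)
...   | yes even = ⊥-elim (<⇒≱ ample (a≤-evenPerfect 0<n even perfect))
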